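{- Let $q\equiv 3 \pmod 4$ be a prime power, let $\mathbb{F}_q$ be the finite field of order $q$, and let $P=\{(x,y,z)\in\mathbb{F}_q^3 : z=x^2+y^2\}$ be the paraboloid. Let $X\subset P$. If $|X|\gg q^{5/3}$, then \[\mathcal{E}_{\mathtt{nt}}^+(X)\gg \frac{|X|^4}{q^3}.\]
   Context: A tuple $(a,b,c,d)\in X^4$ is an energy tuple if $a+b=c+d$; it is non-trivial if $a,b,c,d$ are pairwise distinct. $\mathcal{E}_{\mathtt{nt}}^+(X)$ denotes the number of non-trivial energy tuples in $X^4$. The notation $U\gg V$ means $U\ge cV$ for an absolute constant $c>0$; the hypothesis $|X|\gg q^{5/3}$ means $|X|\ge Cq^{5/3}$ for a sufficiently large absolute constant $C$. -}

module Defs where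

open import Level using (0ℓ)
open import Algebra.Bundles using (CommutativeRing)
open import Data.Nat using (ℕ)
open import Data.Product using (Σ; ∃; _×_; _,_)
open import Data.List using (List; length; filter; cartesianProduct)
open import Data.List.Relation.Unary.Any using (Any)
open import Data.List.Relation.Unary.All using (All)
open import Data.List.Relation.Unary.AllPairs using (AllPairs)
open import Relation.Nullary using (¬_; Dec; yes; no)
open import Relation.Nullary.Decidable using (_×-dec_; ¬?)
open import Relation.Binary using (Decidable)

record FiniteField : Set₁ where
  field
    commRing   : CommutativeRing 0ℓ 0ℓ
  open CommutativeRing commRing public
  field
    _≟_        : Decidable _≈_
    nontrivial : ¬ (0# ≈ 1#)
    inverse    : ∀ x → ¬ (x ≈ 0#) → ∃ λ y → (x * y) ≈ 1#
    elements   : List Carrier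
    complete   : ∀ x → Any (x ≈_) elements
    distinct   : AllPairs (λ x y → ¬ (x ≈ y)) elements

  order : ℕ
  order = length elements

module _ (F : FiniteField) where
  open FiniteField F

  Point : Set
  Point = Carrier × Carrier × Carrier

  _≈P_ : Point → Point → Set
  (x₁ , y₁ , z₁) ≈P (x₂ , y₂ , z₂) = (x₁ ≈ x₂) × (y₁ ≈ y₂) × (z₁ ≈ z₂)

  _≟P_ : Decidable _≈P_
  (x₁ , y₁ , z₁) ≟P (x₂ , y₂ , z₂) = (x₁ ≟ x₂) ×-dec ((y₁ ≟ y₂) ×-dec (z₁ ≟ z₂))

  _+P_ : Point → Point → Point
  (x₁ , y₁ , z₁) +P (x₂ , y₂ , z₂) = (x₁ + x₂ , y₁ + y₂ , z₁ + z₂)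

  OnParaboloid : Point → Set
  OnParaboloid (x , y , z) = z ≈ ((x * x) + (y * y))

  record PointSet : Set where
    field
      pts      : List Point
      noDup    : AllPairs (λ a b → ¬ (a ≈P b)) pts

  points : PointSet → List Point
  points = PointSet.pts

  size : PointSet → ℕ
  size X = length (points X)

  Quad : Set
  Quad = Point × Point × Point × Point

  NontrivialEnergy : Quad → Set
  NontrivialEnergy (a , b , c , d) =
    ((a +P b) ≈P (c +P d)) ×
    (¬ (a ≈P b)) × (¬ (a ≈P c)) × (¬ (a ≈P d)) ×
    (¬ (b ≈P c)) × (¬ (b ≈P d)) × (¬ (c ≈P d))

  nontrivialEnergy? : (t : Quad) → Dec (NontrivialEnergy t)
  nontrivialEnergy? (a , b , c , d) =
    ((a +P b) ≟P (c +P d)) ×-dec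
    (¬? (a ≟P b) ×-dec (¬? (a ≟P c) ×-dec (¬? (a ≟P d) ×-dec
    (¬? (b ≟P c) ×-dec (¬? (b ≟P d) ×-dec ¬? (c ≟P d))))))

  quads : List Point → List Quad
  quads xs = cartesianProduct xs (cartesianProduct xs (cartesianProduct xs xs))

  energyNT : PointSet → ℕ
  energyNT X = length (filter nontrivialEnergy? (quads (points X)))

module Submission where

-- If r(s) counts the pairs (a , b) ∈ X² with a + b = s, then E(X) = Σₛ r(s)² and Σₛ r(s) = |X|²,
-- so Cauchy–Schwarz over the q³ points s gives |X|⁴ ≤ q³ E(X). A trivial energy tuple has two equal
-- entries, which together with a + b = c + d leaves two free entries, so there are at most 4|X|² of
-- them; this is at most |X|⁴ / 2q³ once |X|² ≥ 8q³, which follows from |X|³ ≥ 512 q⁵.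

open import Level using (Level; 0ℓ)
open import Function using (id)
open import Algebra.Bundles using (AbelianGroup)
import Algebra.Construct.DirectProduct as DirectProduct
open import Data.Nat using (ℕ; zero; suc; _+_; _*_; _^_; _≤_; _%_; z≤n; s≤s)
open import Data.Nat.Properties
open import Data.Nat.Tactic.RingSolver using (solve-∀)
open import Data.Nat.Solver using (module +-*-Solver)
open import Data.Empty using (⊥; ⊥-elim)
open import Data.Product using (_×_; _,_; ∃₂; uncurry)
open import Data.Product.Relation.Binary.Pointwise.NonDependent using (_×ₛ_)
open import Data.Sum using (_⊎_; inj₁; inj₂; [_,_]′)
open import Data.List using (List; []; _∷_; _++_; map; length; filter; cartesianProduct)
open import Data.List.Properties using (length-++; length-map)
open import Data.List.Relation.Unary.All as All using (All; []; _∷_)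
open import Data.List.Relation.Unary.AllPairs using ([]; _∷_)
open import Data.List.Relation.Unary.Any using (Any; here; there)
import Data.List.Relation.Unary.Enumerates.Setoid.Properties as Enumerates
import Data.List.Relation.Unary.Unique.Setoid.Properties as Unique
open import Relation.Nullary using (¬_; Dec; yes; no)
open import Relation.Nullary.Decidable using (_×-dec_; _⊎-dec_; ¬?)
open import Relation.Binary using (Setoid; Decidable)
open import Relation.Binary.PropositionalEquality as ≡
  using (_≡_; cong; cong₂; subst; subst₂; module ≡-Reasoning)
open import Defs

private variable
  a b c : Level
  A P : Set a
  B Q : Set b
  R : Set c

∑ : List A → (A → ℕ) → ℕ
∑ []       f = 0
∑ (x ∷ xs) f = f x + ∑ xs f

infix 2 ∑
syntax ∑ xs (λ x → e) = ∑[ x ∈ xs ] e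

∑-cong : ∀ (xs : List A) {f g : A → ℕ} → (∀ x → f x ≡ g x) → ∑ xs f ≡ ∑ xs g
∑-cong []       f≡g = ≡.refl
∑-cong (x ∷ xs) f≡g = cong₂ _+_ (f≡g x) (∑-cong xs f≡g)

∑-mono-≤ : ∀ (xs : List A) {f g : A → ℕ} → (∀ x → f x ≤ g x) → ∑ xs f ≤ ∑ xs g
∑-mono-≤ []       f≤g = z≤n
∑-mono-≤ (x ∷ xs) f≤g = +-mono-≤ (f≤g x) (∑-mono-≤ xs f≤g)

∑-distrib-+ : ∀ (xs : List A) (f g : A → ℕ) →
              (∑[ x ∈ xs ] f x + g x) ≡ ∑ xs f + ∑ xs g
∑-distrib-+ []       f g = ≡.refl
∑-distrib-+ (x ∷ xs) f g = begin
  f x + g x + (∑[ y ∈ xs ] f y + g y) ≡⟨ cong (f x + g x +_) (∑-distrib-+ xs f g) ⟩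
  f x + g x + (∑ xs f + ∑ xs g)       ≡⟨ +-exchange (f x) (g x) (∑ xs f) (∑ xs g) ⟩
  f x + ∑ xs f + (g x + ∑ xs g)       ∎
  where
  open ≡-Reasoning
  +-exchange : ∀ m n o p → m + n + (o + p) ≡ m + o + (n + p)
  +-exchange = solve-∀

*-distribˡ-∑ : ∀ k (xs : List A) (f : A → ℕ) → k * ∑ xs f ≡ (∑[ x ∈ xs ] k * f x)
*-distribˡ-∑ k []       f = *-zeroʳ k
*-distribˡ-∑ k (x ∷ xs) f =
  ≡.trans (*-distribˡ-+ k (f x) (∑ xs f)) (cong (k * f x +_) (*-distribˡ-∑ k xs f))

*-distribʳ-∑ : ∀ k (xs : List A) (f : A → ℕ) → ∑ xs f * k ≡ (∑[ x ∈ xs ] f x * k)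
*-distribʳ-∑ k xs f =
  ≡.trans (*-comm (∑ xs f) k) (≡.trans (*-distribˡ-∑ k xs f) (∑-cong xs (λ x → *-comm k (f x))))

∑-const : ∀ (xs : List A) k → (∑[ _ ∈ xs ] k) ≡ length xs * k
∑-const []       k = ≡.refl
∑-const (x ∷ xs) k = cong (k +_) (∑-const xs k)

∑-≤-length-* : ∀ (xs : List A) k {f : A → ℕ} → (∀ x → f x ≤ k) → ∑ xs f ≤ length xs * k
∑-≤-length-* xs k f≤k = ≤-trans (∑-mono-≤ xs f≤k) (≤-reflexive (∑-const xs k))

∑-++ : ∀ (xs ys : List A) (f : A → ℕ) → ∑ (xs ++ ys) f ≡ ∑ xs f + ∑ ys f
∑-++ []       ys f = ≡.refl
∑-++ (x ∷ xs) ys f = ≡.trans (cong (f x +_) (∑-++ xs ys f)) (≡.sym (+-assoc (f x) (∑ xs f) (∑ ys f)))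

∑-map : ∀ (g : A → B) (xs : List A) (f : B → ℕ) → ∑ (map g xs) f ≡ (∑[ x ∈ xs ] f (g x))
∑-map g []       f = ≡.refl
∑-map g (x ∷ xs) f = cong (f (g x) +_) (∑-map g xs f)

∑-cartesianProduct : ∀ (xs : List A) (ys : List B) (f : A × B → ℕ) →
                     ∑ (cartesianProduct xs ys) f ≡ (∑[ x ∈ xs ] ∑[ y ∈ ys ] f (x , y))
∑-cartesianProduct []       ys f = ≡.refl
∑-cartesianProduct (x ∷ xs) ys f =
  ≡.trans (∑-++ (map (x ,_) ys) (cartesianProduct xs ys) f)
        (cong₂ _+_ (∑-map (x ,_) ys f) (∑-cartesianProduct xs ys f))

∑-comm : ∀ (xs : List A) (ys : List B) (f : A → B → ℕ) →
         (∑[ x ∈ xs ] ∑[ y ∈ ys ] f x y) ≡ (∑[ y ∈ ys ] ∑[ x ∈ xs ] f x y)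
∑-comm []       ys f = ≡.sym (≡.trans (∑-const ys 0) (*-zeroʳ (length ys)))
∑-comm (x ∷ xs) ys f =
  ≡.trans (cong (∑ ys (f x) +_) (∑-comm xs ys f))
        (≡.sym (∑-distrib-+ ys (f x) (λ y → ∑[ x′ ∈ xs ] f x′ y)))

∑-*-∑ : ∀ (xs : List A) (ys : List B) (f : A → ℕ) (g : B → ℕ) →
        (∑[ x ∈ xs ] ∑[ y ∈ ys ] f x * g y) ≡ ∑ xs f * ∑ ys g
∑-*-∑ xs ys f g = begin
  (∑[ x ∈ xs ] ∑[ y ∈ ys ] f x * g y) ≡⟨ ∑-cong xs (λ x → ≡.sym (*-distribˡ-∑ (f x) ys g)) ⟩
  (∑[ x ∈ xs ] f x * ∑ ys g)          ≡⟨ ≡.sym (*-distribʳ-∑ (∑ ys g) xs f) ⟩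
  ∑ xs f * ∑ ys g                     ∎
  where open ≡-Reasoning

length-cartesianProduct : ∀ (xs : List A) (ys : List B) →
                          length (cartesianProduct xs ys) ≡ length xs * length ys
length-cartesianProduct []       ys = ≡.refl
length-cartesianProduct (x ∷ xs) ys = begin
  length (map (x ,_) ys ++ cartesianProduct xs ys)
    ≡⟨ length-++ (map (x ,_) ys) ⟩
  length (map (x ,_) ys) + length (cartesianProduct xs ys)
    ≡⟨ cong₂ _+_ (length-map (x ,_) ys) (length-cartesianProduct xs ys) ⟩
  length ys + length xs * length ys ∎
  where open ≡-Reasoning

2*m*n≤m*m+n*n : ∀ m n → 2 * (m * n) ≤ m * m + n * n
2*m*n≤m*m+n*n m n = [ ordered , flipped ]′ (≤-total m n)
  where
  squares-gap : ∀ m k → 2 * (m * (m + k)) + k * k ≡ m * m + (m + k) * (m + k)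
  squares-gap = solve-∀

  ordered : ∀ {m n} → m ≤ n → 2 * (m * n) ≤ m * m + n * n
  ordered {m} m≤n with k , ≡.refl ← m≤n⇒∃[o]m+o≡n m≤n =
    ≤-trans (m≤m+n _ (k * k)) (≤-reflexive (squares-gap m k))

  flipped : n ≤ m → 2 * (m * n) ≤ m * m + n * n
  flipped n≤m = subst₂ _≤_ (cong (2 *_) (*-comm n m)) (+-comm (n * n) (m * m)) (ordered n≤m)

cauchy-schwarz : ∀ (xs : List A) (f : A → ℕ) → ∑ xs f * ∑ xs f ≤ length xs * (∑[ x ∈ xs ] f x * f x)
cauchy-schwarz xs f = *-cancelˡ-≤ 2 (begin
  2 * (∑ xs f * ∑ xs f)
    ≡⟨ cong (2 *_) (≡.sym (∑-*-∑ xs xs f f)) ⟩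
  2 * (∑[ x ∈ xs ] ∑[ y ∈ xs ] f x * f y)
    ≡⟨ *-distribˡ-∑ 2 xs _ ⟩
  (∑[ x ∈ xs ] 2 * (∑[ y ∈ xs ] f x * f y))
    ≡⟨ ∑-cong xs (λ x → *-distribˡ-∑ 2 xs _) ⟩
  (∑[ x ∈ xs ] ∑[ y ∈ xs ] 2 * (f x * f y))
    ≤⟨ ∑-mono-≤ xs (λ x → ∑-mono-≤ xs (λ y → 2*m*n≤m*m+n*n (f x) (f y))) ⟩
  (∑[ x ∈ xs ] ∑[ y ∈ xs ] f x * f x + f y * f y)
    ≡⟨ ∑-cong xs (λ x → ∑-distrib-+ xs _ _) ⟩
  (∑[ x ∈ xs ] (∑[ _ ∈ xs ] f x * f x) + ∑f²)
    ≡⟨ ∑-distrib-+ xs _ _ ⟩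
  (∑[ x ∈ xs ] ∑[ _ ∈ xs ] f x * f x) + (∑[ _ ∈ xs ] ∑f²)
    ≡⟨ cong₂ _+_ (∑-comm xs xs _) (∑-const xs ∑f²) ⟩
  (∑[ _ ∈ xs ] ∑f²) + length xs * ∑f²
    ≡⟨ cong (_+ length xs * ∑f²) (∑-const xs ∑f²) ⟩
  length xs * ∑f² + length xs * ∑f²
    ≡⟨ cong (length xs * ∑f² +_) (≡.sym (+-identityʳ (length xs * ∑f²))) ⟩
  2 * (length xs * ∑f²) ∎)
  where
  open ≤-Reasoning
  ∑f² : ℕ
  ∑f² = ∑[ x ∈ xs ] f x * f x

∑²-cong : ∀ (xs : List A) (ys : List B) {f g : A → B → ℕ} → (∀ x y → f x y ≡ g x y) →
          (∑[ x ∈ xs ] ∑[ y ∈ ys ] f x y) ≡ (∑[ x ∈ xs ] ∑[ y ∈ ys ] g x y)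
∑²-cong xs ys f≡g = ∑-cong xs (λ x → ∑-cong ys (f≡g x))

∑²-*-≤-1 : ∀ (xs : List A) (ys : List B) {f : A → ℕ} {g : A → B → ℕ} →
           ∑ xs f ≤ 1 → (∀ x → ∑ ys (g x) ≤ 1) → (∑[ x ∈ xs ] ∑[ y ∈ ys ] f x * g x y) ≤ 1
∑²-*-≤-1 xs ys {f} {g} ∑f≤1 ∑g≤1 = begin
  (∑[ x ∈ xs ] ∑[ y ∈ ys ] f x * g x y) ≡⟨ ∑-cong xs (λ x → ≡.sym (*-distribˡ-∑ (f x) ys (g x))) ⟩
  (∑[ x ∈ xs ] f x * ∑ ys (g x))        ≤⟨ ∑-mono-≤ xs (λ x → *-monoʳ-≤ (f x) (∑g≤1 x)) ⟩
  (∑[ x ∈ xs ] f x * 1)                 ≡⟨ ∑-cong xs (λ x → *-identityʳ (f x)) ⟩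
  ∑ xs f                                ≤⟨ ∑f≤1 ⟩
  1                                     ∎
  where open ≤-Reasoning

∑⁴ : List A → (A → A → A → A → ℕ) → ℕ
∑⁴ xs f = ∑[ a ∈ xs ] ∑[ b ∈ xs ] ∑[ c ∈ xs ] ∑[ d ∈ xs ] f a b c d

module _ (xs : List A) where

  ∑⁴-cong : ∀ {f g : A → A → A → A → ℕ} → (∀ a b c d → f a b c d ≡ g a b c d) →
            ∑⁴ xs f ≡ ∑⁴ xs g
  ∑⁴-cong f≡g = ∑²-cong xs xs (λ a b → ∑²-cong xs xs (f≡g a b))

  ∑⁴-mono-≤ : ∀ {f g : A → A → A → A → ℕ} → (∀ a b c d → f a b c d ≤ g a b c d) →
              ∑⁴ xs f ≤ ∑⁴ xs g
  ∑⁴-mono-≤ f≤g =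
    ∑-mono-≤ xs (λ a → ∑-mono-≤ xs (λ b → ∑-mono-≤ xs (λ c → ∑-mono-≤ xs (f≤g a b c))))

  ∑⁴-distrib-+ : ∀ (f g : A → A → A → A → ℕ) →
                 ∑⁴ xs (λ a b c d → f a b c d + g a b c d) ≡ ∑⁴ xs f + ∑⁴ xs g
  ∑⁴-distrib-+ f g = ≡.trans
    (∑-cong xs (λ a → ≡.trans
      (∑-cong xs (λ b → ≡.trans
        (∑-cong xs (λ c → ∑-distrib-+ xs (f a b c) (g a b c)))
        (∑-distrib-+ xs _ _)))
      (∑-distrib-+ xs _ _)))
    (∑-distrib-+ xs _ _)

  -- The subscripts name the two coordinates that determine the other two.
  ∑⁴-≤-length²₁₂ : ∀ {f : A → A → A → A → ℕ} →
                   (∀ a b → (∑[ c ∈ xs ] ∑[ d ∈ xs ] f a b c d) ≤ 1) → ∑⁴ xs f ≤ length xs ^ 2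
  ∑⁴-≤-length²₁₂ ∑≤1 = ∑-≤-length-* xs (length xs * 1) (λ a → ∑-≤-length-* xs 1 (∑≤1 a))

  ∑⁴-≤-length²₁₃ : ∀ {f : A → A → A → A → ℕ} →
                   (∀ a c → (∑[ b ∈ xs ] ∑[ d ∈ xs ] f a b c d) ≤ 1) → ∑⁴ xs f ≤ length xs ^ 2
  ∑⁴-≤-length²₁₃ {f} ∑≤1 = ≤-trans
    (≤-reflexive (∑-cong xs (λ a → ∑-comm xs xs (λ b c → ∑[ d ∈ xs ] f a b c d))))
    (∑⁴-≤-length²₁₂ ∑≤1)

𝟙 : Dec P → ℕ
𝟙 (yes _) = 1
𝟙 (no  _) = 0

𝟙-cong : (P → Q) → (Q → P) → (p? : Dec P) (q? : Dec Q) → 𝟙 p? ≡ 𝟙 q?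
𝟙-cong P→Q Q→P (yes p) (yes q) = ≡.refl
𝟙-cong P→Q Q→P (no  _) (no  _) = ≡.refl
𝟙-cong P→Q Q→P (yes p) (no ¬q) = ⊥-elim (¬q (P→Q p))
𝟙-cong P→Q Q→P (no ¬p) (yes q) = ⊥-elim (¬p (Q→P q))

𝟙-idem : (p? : Dec P) → 𝟙 p? * 𝟙 p? ≡ 𝟙 p?
𝟙-idem (yes _) = ≡.refl
𝟙-idem (no  _) = ≡.refl

𝟙-× : (p? : Dec P) (q? : Dec Q) → 𝟙 (p? ×-dec q?) ≡ 𝟙 p? * 𝟙 q?
𝟙-× (yes _) (yes _) = ≡.refl
𝟙-× (yes _) (no  _) = ≡.refl
𝟙-× (no  _) _       = ≡.refl

𝟙-disjoint : (P → Q → ⊥) → (p? : Dec P) (q? : Dec Q) → 𝟙 p? * 𝟙 q? ≡ 0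
𝟙-disjoint P→¬Q (yes p) (yes q) = ⊥-elim (P→¬Q p q)
𝟙-disjoint P→¬Q (yes _) (no  _) = ≡.refl
𝟙-disjoint P→¬Q (no  _) _       = ≡.refl

𝟙-cover : (P → Q ⊎ R) → (p? : Dec P) (q? : Dec Q) (r? : Dec R) → 𝟙 p? ≤ 𝟙 q? + 𝟙 r?
𝟙-cover cover (no _)  _       _       = z≤n
𝟙-cover cover (yes p) (yes _) _       = s≤s z≤n
𝟙-cover cover (yes p) (no ¬q) r? with cover p
... | inj₁ q = ⊥-elim (¬q q)
... | inj₂ r = ≤-reflexive (≡.sym (𝟙-yes r r?))
  where
  𝟙-yes : R → (r? : Dec R) → 𝟙 r? ≡ 1
  𝟙-yes r (yes _) = ≡.refl
  𝟙-yes r (no ¬r) = ⊥-elim (¬r r)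

𝟙-⊎ : (p? : Dec P) (q? : Dec Q) → 𝟙 (p? ⊎-dec q?) ≤ 𝟙 p? + 𝟙 q?
𝟙-⊎ p? q? = 𝟙-cover id (p? ⊎-dec q?) p? q?

𝟙-⊎⁴ : ∀ {d} {S : Set d} (p? : Dec P) (q? : Dec Q) (r? : Dec R) (s? : Dec S) →
       𝟙 (p? ⊎-dec q? ⊎-dec r? ⊎-dec s?) ≤ 𝟙 p? + (𝟙 q? + (𝟙 r? + 𝟙 s?))
𝟙-⊎⁴ p? q? r? s? =
  ≤-trans (𝟙-⊎ p? _) (+-monoʳ-≤ (𝟙 p?) (≤-trans (𝟙-⊎ q? _) (+-monoʳ-≤ (𝟙 q?) (𝟙-⊎ r? s?))))

module _ {p} {P : A → Set p} (P? : ∀ x → Dec (P x)) where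

  length-filter≡∑𝟙 : ∀ xs → length (filter P? xs) ≡ (∑[ x ∈ xs ] 𝟙 (P? x))
  length-filter≡∑𝟙 []       = ≡.refl
  length-filter≡∑𝟙 (x ∷ xs) with P? x
  ... | yes _ = cong suc (length-filter≡∑𝟙 xs)
  ... | no  _ = length-filter≡∑𝟙 xs

  ∑𝟙≡0 : ∀ {xs} → All (λ x → ¬ P x) xs → (∑[ x ∈ xs ] 𝟙 (P? x)) ≡ 0
  ∑𝟙≡0 []             = ≡.refl
  ∑𝟙≡0 {x ∷ _} (¬px ∷ ¬pxs) with P? x
  ... | yes px = ⊥-elim (¬px px)
  ... | no  _  = ∑𝟙≡0 ¬pxs

  ∑𝟙-≥-1 : ∀ {xs} → Any P xs → 1 ≤ (∑[ x ∈ xs ] 𝟙 (P? x))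
  ∑𝟙-≥-1 {x ∷ xs} (here px) with P? x
  ... | yes _  = s≤s z≤n
  ... | no ¬px = ⊥-elim (¬px px)
  ∑𝟙-≥-1 {x ∷ xs} (there pxs) = ≤-trans (∑𝟙-≥-1 pxs) (m≤n+m _ (𝟙 (P? x)))

module Counting {c ℓ} (S : Setoid c ℓ) where

  open Setoid S
  open import Data.List.Relation.Unary.Unique.Setoid S using (Unique)
  open import Data.List.Relation.Unary.Enumerates.Setoid S using (IsEnumeration)

  ∑𝟙-≤-1 : ∀ {p} {P : Carrier → Set p} (P? : ∀ x → Dec (P x)) →
           (∀ {x y} → P x → P y → x ≈ y) → ∀ {xs} → Unique xs → (∑[ x ∈ xs ] 𝟙 (P? x)) ≤ 1
  ∑𝟙-≤-1 P? P-unique {[]}     []              = z≤n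
  ∑𝟙-≤-1 P? P-unique {x ∷ xs} (x≉xs ∷ unique) with P? x
  ... | no  _  = ∑𝟙-≤-1 P? P-unique unique
  ... | yes px = ≤-reflexive (cong suc (∑𝟙≡0 P? (All.map (λ x≉y py → x≉y (P-unique px py)) x≉xs)))

  module _ (_≟_ : Decidable _≈_) where

    ∑𝟙≈-≤-1 : ∀ u {xs} → Unique xs → (∑[ x ∈ xs ] 𝟙 (u ≟ x)) ≤ 1
    ∑𝟙≈-≤-1 u = ∑𝟙-≤-1 (u ≟_) (λ u≈x u≈y → trans (sym u≈x) u≈y)

    module _ {ss} (enumerates : IsEnumeration ss) (unique : Unique ss) where

      ∑𝟙≈-enumeration : ∀ u → (∑[ s ∈ ss ] 𝟙 (u ≟ s)) ≡ 1
      ∑𝟙≈-enumeration u = ≤-antisym (∑𝟙≈-≤-1 u unique) (∑𝟙-≥-1 (u ≟_) (enumerates u))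

      ∑𝟙≈*𝟙≈-enumeration : ∀ u v → (∑[ s ∈ ss ] 𝟙 (u ≟ s) * 𝟙 (v ≟ s)) ≡ 𝟙 (u ≟ v)
      ∑𝟙≈*𝟙≈-enumeration u v with u ≟ v
      ... | yes u≈v = begin
        (∑[ s ∈ ss ] 𝟙 (u ≟ s) * 𝟙 (v ≟ s))
          ≡⟨ ∑-cong ss (λ s → cong (𝟙 (u ≟ s) *_)
               (𝟙-cong (trans u≈v) (trans (sym u≈v)) (v ≟ s) (u ≟ s))) ⟩
        (∑[ s ∈ ss ] 𝟙 (u ≟ s) * 𝟙 (u ≟ s))
          ≡⟨ ∑-cong ss (λ s → 𝟙-idem (u ≟ s)) ⟩
        (∑[ s ∈ ss ] 𝟙 (u ≟ s))
          ≡⟨ ∑𝟙≈-enumeration u ⟩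
        1 ∎
        where open ≡-Reasoning
      ... | no u≉v = ≡.trans
        (∑-cong ss (λ s → 𝟙-disjoint (λ u≈s v≈s → u≉v (trans u≈s (sym v≈s))) (u ≟ s) (v ≟ s)))
        (≡.trans (∑-const ss 0) (*-zeroʳ (length ss)))

module Collisions {c ℓ} (S : Setoid c ℓ) (_≟_ : Decidable (Setoid._≈_ S))
                  {P : Set a} (σ : P → Setoid.Carrier S) where

  open Setoid S using (Carrier)
  open import Data.List.Relation.Unary.Unique.Setoid S using (Unique)
  open import Data.List.Relation.Unary.Enumerates.Setoid S using (IsEnumeration)
  open Counting S

  fibre : List P → Carrier → ℕ
  fibre ps s = ∑[ p ∈ ps ] 𝟙 (σ p ≟ s)

  collisions : List P → ℕ
  collisions ps = ∑[ p ∈ ps ] ∑[ p′ ∈ ps ] 𝟙 (σ p ≟ σ p′)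

  module _ {ss} (enumerates : IsEnumeration ss) (unique : Unique ss) (ps : List P) where

    ∑-fibre : (∑[ s ∈ ss ] fibre ps s) ≡ length ps
    ∑-fibre = begin
      (∑[ s ∈ ss ] ∑[ p ∈ ps ] 𝟙 (σ p ≟ s))
        ≡⟨ ∑-comm ss ps _ ⟩
      (∑[ p ∈ ps ] ∑[ s ∈ ss ] 𝟙 (σ p ≟ s))
        ≡⟨ ∑-cong ps (λ p → ∑𝟙≈-enumeration _≟_ enumerates unique (σ p)) ⟩
      (∑[ p ∈ ps ] 1)
        ≡⟨ ∑-const ps 1 ⟩
      length ps * 1
        ≡⟨ *-identityʳ (length ps) ⟩
      length ps ∎
      where open ≡-Reasoning

    collisions≡∑fibre² : collisions ps ≡ (∑[ s ∈ ss ] fibre ps s * fibre ps s)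
    collisions≡∑fibre² = begin
      collisions ps
        ≡⟨ ∑²-cong ps ps (λ p p′ →
             ≡.sym (∑𝟙≈*𝟙≈-enumeration _≟_ enumerates unique (σ p) (σ p′))) ⟩
      (∑[ p ∈ ps ] ∑[ p′ ∈ ps ] ∑[ s ∈ ss ] 𝟙 (σ p ≟ s) * 𝟙 (σ p′ ≟ s))
        ≡⟨ ∑-cong ps (λ p → ∑-comm ps ss _) ⟩
      (∑[ p ∈ ps ] ∑[ s ∈ ss ] ∑[ p′ ∈ ps ] 𝟙 (σ p ≟ s) * 𝟙 (σ p′ ≟ s))
        ≡⟨ ∑-comm ps ss _ ⟩
      (∑[ s ∈ ss ] ∑[ p ∈ ps ] ∑[ p′ ∈ ps ] 𝟙 (σ p ≟ s) * 𝟙 (σ p′ ≟ s))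
        ≡⟨ ∑-cong ss (λ s → ∑-*-∑ ps ps _ _) ⟩
      (∑[ s ∈ ss ] fibre ps s * fibre ps s) ∎
      where open ≡-Reasoning

    length²≤|ss|*collisions : length ps * length ps ≤ length ss * collisions ps
    length²≤|ss|*collisions = subst₂ _≤_
      (cong₂ _*_ ∑-fibre ∑-fibre)
      (cong (length ss *_) (≡.sym collisions≡∑fibre²))
      (cauchy-schwarz ss (fibre ps))

module AdditiveEnergy {g ℓ} (G : AbelianGroup g ℓ) (_≟_ : Decidable (AbelianGroup._≈_ G)) where

  open AbelianGroup G
  open import Algebra.Properties.Group group using (∙-cancelˡ)
  open import Data.List.Relation.Unary.Unique.Setoid setoid using (Unique)
  open import Data.List.Relation.Unary.Enumerates.Setoid setoid using (IsEnumeration)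
  open Counting setoid using (∑𝟙-≤-1; ∑𝟙≈-≤-1)
  open Collisions setoid _≟_ (uncurry _∙_) using (collisions; length²≤|ss|*collisions)

  IsEnergyTuple : Carrier → Carrier → Carrier → Carrier → Set ℓ
  IsEnergyTuple a b c d = a ∙ b ≈ c ∙ d

  IsNontrivialEnergyTuple : Carrier → Carrier → Carrier → Carrier → Set ℓ
  IsNontrivialEnergyTuple a b c d =
    IsEnergyTuple a b c d × ¬ a ≈ b × ¬ a ≈ c × ¬ a ≈ d × ¬ b ≈ c × ¬ b ≈ d × ¬ c ≈ d

  -- Under a ∙ b ≈ c ∙ d, b ≈ c forces a ≈ d and b ≈ d forces a ≈ c, so these four shapes
  -- cover every energy tuple that is not non-trivial.
  IsDegenerateEnergyTuple : Carrier → Carrier → Carrier → Carrier → Set ℓ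
  IsDegenerateEnergyTuple a b c d =
    a ≈ c × b ≈ d ⊎ a ≈ d × b ≈ c ⊎ a ≈ b × IsEnergyTuple a b c d ⊎ c ≈ d × IsEnergyTuple a b c d

  isEnergyTuple? : ∀ a b c d → Dec (IsEnergyTuple a b c d)
  isEnergyTuple? a b c d = (a ∙ b) ≟ (c ∙ d)

  isNontrivialEnergyTuple? : ∀ a b c d → Dec (IsNontrivialEnergyTuple a b c d)
  isNontrivialEnergyTuple? a b c d = isEnergyTuple? a b c d ×-dec
    ¬? (a ≟ b) ×-dec ¬? (a ≟ c) ×-dec ¬? (a ≟ d) ×-dec ¬? (b ≟ c) ×-dec ¬? (b ≟ d) ×-dec ¬? (c ≟ d)

  energy : List Carrier → ℕ
  energy xs = ∑⁴ xs (λ a b c d → 𝟙 (isEnergyTuple? a b c d))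

  nontrivialEnergy : List Carrier → ℕ
  nontrivialEnergy xs = ∑⁴ xs (λ a b c d → 𝟙 (isNontrivialEnergyTuple? a b c d))

  energy≡collisions : ∀ xs → energy xs ≡ collisions (cartesianProduct xs xs)
  energy≡collisions xs = ≡.sym (≡.trans
    (∑-cartesianProduct xs xs _)
    (∑²-cong xs xs (λ a b → ∑-cartesianProduct xs xs _)))

  |xs|⁴≤|ss|*energy : ∀ {ss} → IsEnumeration ss → Unique ss →
                       ∀ xs → length xs ^ 4 ≤ length ss * energy xs
  |xs|⁴≤|ss|*energy {ss} enumerates unique xs = subst₂ _≤_
    (≡.trans (cong₂ _*_ |xs×xs| |xs×xs|) (square-of-square (length xs)))
    (cong (length ss *_) (≡.sym (energy≡collisions xs)))
    (length²≤|ss|*collisions enumerates unique (cartesianProduct xs xs))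
    where
    |xs×xs| : length (cartesianProduct xs xs) ≡ length xs * length xs
    |xs×xs| = length-cartesianProduct xs xs
    square-of-square : ∀ n → n * n * (n * n) ≡ n * (n * (n * (n * 1)))
    square-of-square = solve-∀

  energyTuple-cancelˡ : ∀ {a b c d} → IsEnergyTuple a b c d → a ≈ c → b ≈ d
  energyTuple-cancelˡ {a} {b} {c} {d} ab≈cd a≈c = ∙-cancelˡ c b d (trans (∙-congʳ (sym a≈c)) ab≈cd)

  energyTuple-classification : ∀ {a b c d} → IsEnergyTuple a b c d →
    IsNontrivialEnergyTuple a b c d ⊎ IsDegenerateEnergyTuple a b c d
  energyTuple-classification {a} {b} {c} {d} ab≈cd with a ≟ c | a ≟ d | a ≟ b | c ≟ d
  ... | yes a≈c | _       | _       | _       = inj₂ (inj₁ (a≈c , energyTuple-cancelˡ ab≈cd a≈c))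
  ... | no _    | yes a≈d | _       | _       =
    inj₂ (inj₂ (inj₁ (a≈d , energyTuple-cancelˡ (trans ab≈cd (comm c d)) a≈d)))
  ... | no _    | no _    | yes a≈b | _       = inj₂ (inj₂ (inj₂ (inj₁ (a≈b , ab≈cd))))
  ... | no _    | no _    | no _    | yes c≈d = inj₂ (inj₂ (inj₂ (inj₂ (c≈d , ab≈cd))))
  ... | no a≉c  | no a≉d  | no a≉b  | no c≉d  = inj₁ (ab≈cd , a≉b , a≉c , a≉d , b≉c , b≉d , c≉d)
    where
    b≉c : ¬ b ≈ c
    b≉c b≈c = a≉d (energyTuple-cancelˡ (trans (comm b a) ab≈cd) b≈c)
    b≉d : ¬ b ≈ d
    b≉d b≈d = a≉c (energyTuple-cancelˡ (trans (comm b a) (trans ab≈cd (comm c d))) b≈d)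

  isDegenerateEnergyTuple? : ∀ a b c d → Dec (IsDegenerateEnergyTuple a b c d)
  isDegenerateEnergyTuple? a b c d =
    (a ≟ c ×-dec b ≟ d) ⊎-dec (a ≟ d ×-dec b ≟ c) ⊎-dec
    (a ≟ b ×-dec isEnergyTuple? a b c d) ⊎-dec (c ≟ d ×-dec isEnergyTuple? a b c d)

  module _ {xs} (unique : Unique xs) where

    ∑²𝟙≈×𝟙≈-≤-1 : ∀ u v → (∑[ x ∈ xs ] ∑[ y ∈ xs ] 𝟙 (u ≟ x ×-dec v ≟ y)) ≤ 1
    ∑²𝟙≈×𝟙≈-≤-1 u v = ≤-trans
      (≤-reflexive (∑²-cong xs xs (λ x y → 𝟙-× (u ≟ x) (v ≟ y))))
      (∑²-*-≤-1 xs xs (∑𝟙≈-≤-1 _≟_ u unique) (λ _ → ∑𝟙≈-≤-1 _≟_ v unique))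

    ∑𝟙-energyTuple-≤-1ʳ : ∀ a b c → (∑[ d ∈ xs ] 𝟙 (isEnergyTuple? a b c d)) ≤ 1
    ∑𝟙-energyTuple-≤-1ʳ a b c = ∑𝟙-≤-1 (isEnergyTuple? a b c)
      (λ ab≈cd ab≈cd′ → energyTuple-cancelˡ (trans (sym ab≈cd) ab≈cd′) refl) unique

    ∑𝟙-energyTuple-≤-1ˡ : ∀ a c d → (∑[ b ∈ xs ] 𝟙 (isEnergyTuple? a b c d)) ≤ 1
    ∑𝟙-energyTuple-≤-1ˡ a c d = ∑𝟙-≤-1 (λ b → isEnergyTuple? a b c d)
      (λ ab≈cd ab′≈cd → energyTuple-cancelˡ (trans ab≈cd (sym ab′≈cd)) refl) unique

    ∑²𝟙-a≈b×energyTuple-≤-1 : ∀ a c →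
      (∑[ b ∈ xs ] ∑[ d ∈ xs ] 𝟙 (a ≟ b ×-dec isEnergyTuple? a b c d)) ≤ 1
    ∑²𝟙-a≈b×energyTuple-≤-1 a c = ≤-trans
      (≤-reflexive (∑²-cong xs xs (λ b d → 𝟙-× (a ≟ b) (isEnergyTuple? a b c d))))
      (∑²-*-≤-1 xs xs (∑𝟙≈-≤-1 _≟_ a unique) (λ b → ∑𝟙-energyTuple-≤-1ʳ a b c))

    ∑²𝟙-c≈d×energyTuple-≤-1 : ∀ a c →
      (∑[ d ∈ xs ] ∑[ b ∈ xs ] 𝟙 (c ≟ d ×-dec isEnergyTuple? a b c d)) ≤ 1
    ∑²𝟙-c≈d×energyTuple-≤-1 a c = ≤-trans
      (≤-reflexive (∑²-cong xs xs (λ d b → 𝟙-× (c ≟ d) (isEnergyTuple? a b c d))))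
      (∑²-*-≤-1 xs xs (∑𝟙≈-≤-1 _≟_ c unique) (λ d → ∑𝟙-energyTuple-≤-1ˡ a c d))

    ∑⁴𝟙-degenerate≤4*|xs|² :
      ∑⁴ xs (λ a b c d → 𝟙 (isDegenerateEnergyTuple? a b c d)) ≤ 4 * length xs ^ 2
    ∑⁴𝟙-degenerate≤4*|xs|² = begin
      ∑⁴ xs (λ a b c d → 𝟙 (isDegenerateEnergyTuple? a b c d))
        ≤⟨ ∑⁴-mono-≤ xs (λ a b c d → 𝟙-⊎⁴ (a ≟ c ×-dec b ≟ d) (a ≟ d ×-dec b ≟ c)
             (a ≟ b ×-dec isEnergyTuple? a b c d) (c ≟ d ×-dec isEnergyTuple? a b c d)) ⟩
      ∑⁴ xs (λ a b c d → D₁ a b c d + (D₂ a b c d + (D₃ a b c d + D₄ a b c d)))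
        ≡⟨ ≡.trans (∑⁴-distrib-+ xs D₁ _) (cong (∑⁴ xs D₁ +_)
             (≡.trans (∑⁴-distrib-+ xs D₂ _) (cong (∑⁴ xs D₂ +_) (∑⁴-distrib-+ xs D₃ D₄)))) ⟩
      ∑⁴ xs D₁ + (∑⁴ xs D₂ + (∑⁴ xs D₃ + ∑⁴ xs D₄))
        ≤⟨ +-mono-≤ (∑⁴-≤-length²₁₂ xs (∑²𝟙≈×𝟙≈-≤-1))
           (+-mono-≤ (∑⁴-≤-length²₁₂ xs (λ a b → ≤-trans (≤-reflexive (∑-comm xs xs _))
                                                          (∑²𝟙≈×𝟙≈-≤-1 a b)))
           (+-mono-≤ (∑⁴-≤-length²₁₃ xs ∑²𝟙-a≈b×energyTuple-≤-1)
                     (∑⁴-≤-length²₁₃ xs (λ a c → ≤-trans (≤-reflexive (∑-comm xs xs _))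
                                                          (∑²𝟙-c≈d×energyTuple-≤-1 a c))))) ⟩
      n² + (n² + (n² + n²))
        ≡⟨ four-times n² ⟩
      4 * n² ∎
      where
      open ≤-Reasoning
      n² : ℕ
      n² = length xs ^ 2
      four-times : ∀ m → m + (m + (m + m)) ≡ 4 * m
      four-times = solve-∀
      D₁ D₂ D₃ D₄ : Carrier → Carrier → Carrier → Carrier → ℕ
      D₁ a b c d = 𝟙 (a ≟ c ×-dec b ≟ d)
      D₂ a b c d = 𝟙 (a ≟ d ×-dec b ≟ c)
      D₃ a b c d = 𝟙 (a ≟ b ×-dec isEnergyTuple? a b c d)
      D₄ a b c d = 𝟙 (c ≟ d ×-dec isEnergyTuple? a b c d)

    energy≤nontrivialEnergy+4*|xs|² : energy xs ≤ nontrivialEnergy xs + 4 * length xs ^ 2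
    energy≤nontrivialEnergy+4*|xs|² = begin
      energy xs
        ≤⟨ ∑⁴-mono-≤ xs (λ a b c d → 𝟙-cover energyTuple-classification
             (isEnergyTuple? a b c d) (isNontrivialEnergyTuple? a b c d) (isDegenerateEnergyTuple? a b c d)) ⟩
      ∑⁴ xs (λ a b c d → 𝟙 (isNontrivialEnergyTuple? a b c d) + 𝟙 (isDegenerateEnergyTuple? a b c d))
        ≡⟨ ∑⁴-distrib-+ xs _ _ ⟩
      nontrivialEnergy xs + ∑⁴ xs (λ a b c d → 𝟙 (isDegenerateEnergyTuple? a b c d))
        ≤⟨ +-monoʳ-≤ (nontrivialEnergy xs) ∑⁴𝟙-degenerate≤4*|xs|² ⟩
      nontrivialEnergy xs + 4 * length xs ^ 2 ∎
      where open ≤-Reasoning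

^-≤-^-+ : ∀ m k j → m ^ suc k ≤ m ^ (suc k + j)
^-≤-^-+ zero      k j = z≤n
^-≤-^-+ m@(suc _) k j = ^-monoʳ-≤ m (m≤m+n (suc k) j)

c*q³≤n² : ∀ c n q → c ^ 3 * q ^ 5 ≤ n ^ 3 → c * q ^ 3 ≤ n ^ 2
c*q³≤n² c n q c³q⁵≤n³ = ≮⇒≥ (λ n²<cq³ → <⇒≱ (^-monoˡ-< 3 n²<cq³) cubes-≤)
  where
  open ≤-Reasoning
  open +-*-Solver
  cubes-≤ : (c * q ^ 3) ^ 3 ≤ (n ^ 2) ^ 3
  cubes-≤ = begin
    (c * q ^ 3) ^ 3     ≡⟨ solve 2 (λ c q → (c :* q :^ 3) :^ 3 := c :^ 3 :* q :^ 9) ≡.refl c q ⟩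
    c ^ 3 * q ^ 9       ≤⟨ *-mono-≤ (^-≤-^-+ c 2 3) (^-≤-^-+ q 8 1) ⟩
    c ^ 6 * q ^ 10      ≡⟨ solve 2 (λ c q → c :^ 6 :* q :^ 10 := (c :^ 3 :* q :^ 5) :^ 2) ≡.refl c q ⟩
    (c ^ 3 * q ^ 5) ^ 2 ≤⟨ ^-monoˡ-≤ 2 c³q⁵≤n³ ⟩
    (n ^ 3) ^ 2         ≡⟨ solve 1 (λ n → (n :^ 3) :^ 2 := (n :^ 2) :^ 3) ≡.refl n ⟩
    (n ^ 2) ^ 3         ∎

n⁴≤2*m*q³ : ∀ n q e m → n ^ 4 ≤ q ^ 3 * e → e ≤ m + 4 * n ^ 2 → 8 * q ^ 3 ≤ n ^ 2 →
            n ^ 4 ≤ 2 * m * q ^ 3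
n⁴≤2*m*q³ n q e m n⁴≤q³*e e≤m+4n² 8q³≤n² = +-cancelʳ-≤ (n ^ 4) (n ^ 4) (2 * m * q ^ 3) (begin
  n ^ 4 + n ^ 4
    ≡⟨ solve 1 (λ n → n :^ 4 :+ n :^ 4 := con 2 :* n :^ 4) ≡.refl n ⟩
  2 * n ^ 4
    ≤⟨ *-monoʳ-≤ 2 (≤-trans n⁴≤q³*e (*-monoʳ-≤ (q ^ 3) e≤m+4n²)) ⟩
  2 * (q ^ 3 * (m + 4 * n ^ 2))
    ≡⟨ solve 3 (λ n q m → con 2 :* (q :^ 3 :* (m :+ con 4 :* n :^ 2))
                       := con 2 :* m :* q :^ 3 :+ n :^ 2 :* (con 8 :* q :^ 3)) ≡.refl n q m ⟩
  2 * m * q ^ 3 + n ^ 2 * (8 * q ^ 3)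
    ≤⟨ +-monoʳ-≤ (2 * m * q ^ 3) (*-monoʳ-≤ (n ^ 2) 8q³≤n²) ⟩
  2 * m * q ^ 3 + n ^ 2 * n ^ 2
    ≡⟨ cong (2 * m * q ^ 3 +_) (solve 1 (λ n → n :^ 2 :* n :^ 2 := n :^ 4) ≡.refl n) ⟩
  2 * m * q ^ 3 + n ^ 4 ∎)
  where
  open ≤-Reasoning
  open +-*-Solver

module AffineSpace (F : FiniteField) where

  open FiniteField F using (+-abelianGroup; setoid; elements; complete; distinct; order)

  -- The componentwise equality and addition of points in Defs are definitionally those of this
  -- direct product, so the energy notions of 𝔽³ apply verbatim to Point F.
  𝔽³ : AbelianGroup 0ℓ 0ℓ
  𝔽³ = DirectProduct.abelianGroup +-abelianGroup (DirectProduct.abelianGroup +-abelianGroup +-abelianGroup)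

  open AdditiveEnergy 𝔽³ (_≟P_ F) public
  open import Data.List.Relation.Unary.Unique.Setoid (AbelianGroup.setoid 𝔽³) using (Unique)
  open import Data.List.Relation.Unary.Enumerates.Setoid (AbelianGroup.setoid 𝔽³) using (IsEnumeration)

  points³ : List (Point F)
  points³ = cartesianProduct elements (cartesianProduct elements elements)

  points³-enumerates : IsEnumeration points³
  points³-enumerates = Enumerates.cartesianProduct⁺ setoid (setoid ×ₛ setoid)
    complete (Enumerates.cartesianProduct⁺ setoid setoid complete complete)

  points³-unique : Unique points³
  points³-unique = Unique.cartesianProduct⁺ setoid (setoid ×ₛ setoid)
    distinct (Unique.cartesianProduct⁺ setoid setoid distinct distinct)

  length-points³ : length points³ ≡ order ^ 3
  length-points³ = ≡.trans (length-cartesianProduct elements _)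
    (cong (order *_) (≡.trans (length-cartesianProduct elements elements)
      (cong (order *_) (≡.sym (*-identityʳ order)))))

  |X|⁴≤q³*energy : ∀ X → size F X ^ 4 ≤ order ^ 3 * energy (points F X)
  |X|⁴≤q³*energy X = subst (λ q³ → size F X ^ 4 ≤ q³ * energy (points F X)) length-points³
    (|xs|⁴≤|ss|*energy points³-enumerates points³-unique (points F X))

  energyNT≡nontrivialEnergy : ∀ X → energyNT F X ≡ nontrivialEnergy (points F X)
  energyNT≡nontrivialEnergy X = begin
    length (filter (nontrivialEnergy? F) (quads F xs))
      ≡⟨ length-filter≡∑𝟙 (nontrivialEnergy? F) (quads F xs) ⟩
    (∑[ t ∈ quads F xs ] 𝟙 (nontrivialEnergy? F t))
      ≡⟨ ∑-cartesianProduct xs _ _ ⟩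
    (∑[ a ∈ xs ] ∑[ t ∈ cartesianProduct xs (cartesianProduct xs xs) ] 𝟙 (nontrivialEnergy? F (a , t)))
      ≡⟨ ∑-cong xs (λ a → ≡.trans (∑-cartesianProduct xs _ _)
                                  (∑-cong xs (λ b → ∑-cartesianProduct xs xs _))) ⟩
    ∑⁴ xs (λ a b c d → 𝟙 (nontrivialEnergy? F (a , b , c , d)))
      ≡⟨ ∑⁴-cong xs (λ a b c d → 𝟙-cong id id _ (isNontrivialEnergyTuple? a b c d)) ⟩
    nontrivialEnergy xs ∎
    where
    open ≡-Reasoning
    xs : List (Point F)
    xs = points F X

theorem1p1 : ∃₂ λ (C K : ℕ) → (F : FiniteField) →
    FiniteField.order F % 4 ≡ 3 →
    (X : PointSet F) → All (OnParaboloid F) (points F X) →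
    C * FiniteField.order F ^ 5 ≤ size F X ^ 3 →
    size F X ^ 4 ≤ K * energyNT F X * FiniteField.order F ^ 3
theorem1p1 = 512 , 2 , λ F _ X _ 512*q⁵≤|X|³ →
  let open AffineSpace F
      q = FiniteField.order F
      xs = points F X
  in subst (λ e → size F X ^ 4 ≤ 2 * e * q ^ 3) (≡.sym (energyNT≡nontrivialEnergy X))
       (n⁴≤2*m*q³ (length xs) q (energy xs) (nontrivialEnergy xs)
         (|X|⁴≤q³*energy X)
         (energy≤nontrivialEnergy+4*|xs|² (PointSet.noDup X))
         (c*q³≤n² 8 (length xs) q 512*q⁵≤|X|³))
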